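{- Let $n,m\ge 3$ be integers. Then \[ r_*(K_{1,n},K_{1,m}+e)=\begin{cases} n+m-2 & \text{if } n \text{ and } m \text{ are both even and } n\le m-2,\\ 1 & \text{if } n \text{ or } m \text{ is odd and } n\le m-2,\\ n+1 & \text{if } n>m-2.\end{cases}\]
   Context: $K_{1,n}$ denotes the star with $n$ edges. $K_{1,m}+e$ denotes the graph obtained from the star $K_{1,m}$ by adding one edge joining two of its leaves. For graphs $F,G,H$, $F\rightarrow(G,H)$ means that every red/blue coloring of the edges of $F$ contains a red copy of $G$ or a blue copy of $H$. The Ramsey number $r(G,H)$ is the smallest positive integer $N$ such that $K_N\rightarrow(G,H)$. For $k\ge 1$, $K_{N}\sqcup K_{1,k}$ denotes the graph obtained from the complete graph $K_N$ by adding one new vertex adjacent to exactly $k$ vertices of $K_N$. The star-critical Ramsey number $r_*(G,H)$ is the smallest positive integer $k$ such that $K_{r(G,H)-1}\sqcup K_{1,k}\rightarrow(G,H)$. -}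

module Defs where

open import Data.Nat using (ℕ; zero; suc; _+_; _∸_; _≤_; _<_)
open import Data.Nat.Divisibility using (_∣_)
open import Data.Fin using (Fin; toℕ)
open import Data.Bool using (Bool; true; false)
open import Data.Product using (Σ; _×_; _,_)
open import Data.Sum using (_⊎_)
open import Relation.Nullary using (¬_)
open import Relation.Binary.PropositionalEquality using (_≡_; _≢_)
open import Function.Definitions using (Injective)

record Graph : Set₁ where
  field
    vertices : ℕ
    Adj      : Fin vertices → Fin vertices → Set
open Graph public

K : ℕ → Graph
K N = record { vertices = N ; Adj = λ i j → i ≢ j }

-- Star K_{1,n}: vertex 0 is the centre, vertices 1..n are leaves.
StarAdj : {v : ℕ} → Fin v → Fin v → Set
StarAdj i j = (toℕ i ≡ 0 × toℕ j ≢ 0) ⊎ (toℕ j ≡ 0 × toℕ i ≢ 0)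

Star : ℕ → Graph
Star n = record { vertices = suc n ; Adj = StarAdj }

StarPlusE : ℕ → Graph
StarPlusE m = record
  { vertices = suc m
  ; Adj = λ i j → StarAdj i j
                  ⊎ ((toℕ i ≡ 1 × toℕ j ≡ 2) ⊎ (toℕ i ≡ 2 × toℕ j ≡ 1)) }

-- K_M ⊔ K_{1,k}: vertices 1..M form K_M, vertex 0 is the new vertex,
-- adjacent exactly to the vertices 1..k (i.e. to k vertices when k ≤ M).
KSqStar : ℕ → ℕ → Graph
KSqStar M k = record
  { vertices = suc M
  ; Adj = λ i j → i ≢ j × (toℕ i ≡ 0 → toℕ j ≤ k) × (toℕ j ≡ 0 → toℕ i ≤ k) }

-- Red/blue colourings of the edges of F: a symmetric colour function on
-- pairs of vertices (true = red, false = blue); only values on edges matter.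
Coloring : Graph → Set
Coloring F = Fin (vertices F) → Fin (vertices F) → Bool

SymmetricColoring : (F : Graph) → Coloring F → Set
SymmetricColoring F c = ∀ i j → c i j ≡ c j i

MonoCopy : (F : Graph) → Coloring F → Bool → Graph → Set
MonoCopy F c col G =
  Σ (Fin (vertices G) → Fin (vertices F)) λ f →
    Injective _≡_ _≡_ f ×
    (∀ i j → Adj G i j → Adj F (f i) (f j) × c (f i) (f j) ≡ col)

Arrows : Graph → Graph → Graph → Set
Arrows F G H = (c : Coloring F) → SymmetricColoring F c →
               MonoCopy F c true G ⊎ MonoCopy F c false H

IsRamseyNumber : Graph → Graph → ℕ → Set
IsRamseyNumber G H N =
  1 ≤ N × Arrows (K N) G H × (∀ M → 1 ≤ M → M < N → ¬ Arrows (K M) G H)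

IsStarCriticalRamseyNumber : Graph → Graph → ℕ → Set
IsStarCriticalRamseyNumber G H k =
  Σ ℕ λ M → IsRamseyNumber G H (suc M) ×
    1 ≤ k × Arrows (KSqStar M k) G H ×
    (∀ j → 1 ≤ j → j < k → ¬ Arrows (KSqStar M j) G H)

Even : ℕ → Set
Even n = 2 ∣ n

Odd : ℕ → Set
Odd n = ¬ (2 ∣ n)

-- Take a vertex v adjacent to all others.  If v has fewer than n red neighbours it
-- has many blue ones; for a blue neighbour u of v, either u sends n red edges into the blue
-- neighbourhood of v (a red K_{1,n} at u), or one blue edge uw, and then vu, vw, uw and further
-- blue edges at v form a blue K_{1,m}+e.  For n and m even the host is K_{n+m-1}, of odd order:
-- if no vertex had n red or m blue neighbours, the red graph would be (n-1)-regular, which the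
-- handshake lemma forbids as n-1 is odd.
--
-- Every colouring below has all red degrees < n and all blue degrees < m, except
-- for m ≤ n+1, where K_{2n} ⊔ K_{1,n} is split into the sides {1,…,n} and {0,n+1,…,2n}, red
-- inside them: the blue graph is bipartite and has no triangle.  Otherwise the K_N is coloured
-- as the circulant on ℤ/N whose red edges join points at circular distance ≤ h, plus (n even)
-- the antipodal pairs; for n, m even the extra vertex is joined in red to h antipodal pairs,
-- which then leave the matching.  Degrees are bounded by sending neighbours injectively into
-- short intervals, reading b as seen from a, i.e. b - a + h mod N.

module Submission where

open import Defs
open import Algebra.Properties.CommutativeSemigroup using (interchange)
open import Data.Bool using (Bool; true; false; _∧_; not)
import Data.Bool.Properties as Bool
open import Data.Empty using (⊥; ⊥-elim)
open import Data.Fin using (Fin; zero; suc; toℕ; _≟_; inject≤; fromℕ<)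
import Data.Fin.Properties as Fin
import Data.Nat as ℕ
open import Data.Nat using (ℕ; zero; suc; _+_; _*_; _∸_; _≤_; _<_; z≤n; s≤s; z<s; ∣_-_∣; NonZero; _≤?_; _<?_)
open import Data.Nat.DivMod using (_%_; [m+n]%n≡m%n; m<n⇒m%n≡m; m≤n⇒[n∸m]%m≡n%m; %-distribˡ-+; m%n<n)
open import Data.Nat.Divisibility using (_∣_; divides; ∣m∣n⇒∣m+n; ∣m+n∣m⇒∣n; ∣1⇒≡1; ∣-refl)
open import Data.Nat.Primality using (euclidsLemma; prime[2])
open import Data.Nat.Properties hiding (_≟_)
open import Data.Nat.Tactic.RingSolver using (solve-∀)
open import Data.Product using (Σ; _×_; _,_; proj₁; proj₂)
open import Data.Sum using (_⊎_; inj₁; inj₂; [_,_]′)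
open import Data.Vec.Functional using (_∷_)
open import Function using (_∘_; case_of_)
open import Function.Bundles using (mk⇔)
open import Function.Definitions using (Injective)
open import Relation.Binary.PropositionalEquality
open import Relation.Nullary using (¬_; Dec; does; yes; no; ¬?; _×-dec_; _⊎-dec_)
open import Relation.Nullary.Decidable using (map′; does-⇔)
open import Relation.Unary using (Decidable)

∧-trueˡ : ∀ {a b} → a ∧ b ≡ true → a ≡ true
∧-trueˡ {true} _ = refl

∧-trueʳ : ∀ {a b} → a ∧ b ≡ true → b ≡ true
∧-trueʳ {true} eq = eq

not-true : ∀ {b} → not b ≡ true → b ≡ false
not-true {false} _ = refl

not-≟⇒≢ : ∀ {N} {i j : Fin N} → not (does (i ≟ j)) ≡ true → i ≢ j
not-≟⇒≢ {i = i} {j} eq with i ≟ j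
not-≟⇒≢ () | yes _
not-≟⇒≢ _  | no i≢j = i≢j

does-true : ∀ {A : Set} (a? : Dec A) → does a? ≡ true → A
does-true (yes a) _ = a

does-false : ∀ {A : Set} (a? : Dec A) → does a? ≡ false → ¬ A
does-false (no ¬a) _ = ¬a

∷-injective : ∀ {A : Set} {k} {x : A} {g : Fin k → A} →
  (∀ i → g i ≢ x) → Injective _≡_ _≡_ g → Injective _≡_ _≡_ (x ∷ g)
∷-injective x∉g g-inj {zero}  {zero}  _  = refl
∷-injective x∉g g-inj {zero}  {suc j} eq = ⊥-elim (x∉g j (sym eq))
∷-injective x∉g g-inj {suc i} {zero}  eq = ⊥-elim (x∉g i eq)
∷-injective x∉g g-inj {suc i} {suc j} eq = cong suc (g-inj eq)

boolToℕ : Bool → ℕ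
boolToℕ true  = 1
boolToℕ false = 0

∑ : ∀ {N} → (Fin N → ℕ) → ℕ
∑ {zero}  f = 0
∑ {suc N} f = f zero + ∑ (f ∘ suc)

∑-cong : ∀ {N} {f g : Fin N → ℕ} → (∀ i → f i ≡ g i) → ∑ f ≡ ∑ g
∑-cong {zero}  eq = refl
∑-cong {suc N} eq = cong₂ _+_ (eq zero) (∑-cong (eq ∘ suc))

∑-mono : ∀ {N} {f g : Fin N → ℕ} → (∀ i → f i ≤ g i) → ∑ f ≤ ∑ g
∑-mono {zero}  le = z≤n
∑-mono {suc N} le = +-mono-≤ (le zero) (∑-mono (le ∘ suc))

∑-+ : ∀ {N} (f g : Fin N → ℕ) → ∑ (λ i → f i + g i) ≡ ∑ f + ∑ g
∑-+ {zero}  f g = refl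
∑-+ {suc N} f g =
  trans (cong (f zero + g zero +_) (∑-+ (f ∘ suc) (g ∘ suc))) (interchange +-commutativeSemigroup (f zero) (g zero) _ _)

∑-const : ∀ N c → ∑ {N} (λ _ → c) ≡ N * c
∑-const zero    c = refl
∑-const (suc N) c = cong (c +_) (∑-const N c)

count : ∀ {N} → (Fin N → Bool) → ℕ
count p = ∑ (boolToℕ ∘ p)

count-cong : ∀ {N} {p q : Fin N → Bool} → (∀ j → p j ≡ q j) → count p ≡ count q
count-cong eq = ∑-cong (cong boolToℕ ∘ eq)

count-mono : ∀ {N} {p q : Fin N → Bool} → (∀ j → p j ≡ true → q j ≡ true) → count p ≤ count q
count-mono p⇒q = ∑-mono (λ j → pointwise (p⇒q j))
  where
  pointwise : ∀ {a b} → (a ≡ true → b ≡ true) → boolToℕ a ≤ boolToℕ b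
  pointwise {false} _ = z≤n
  pointwise {true} a⇒b rewrite a⇒b refl = ≤-refl

count-split : ∀ {N} (p q : Fin N → Bool) →
  count p ≡ count (λ j → p j ∧ q j) + count (λ j → p j ∧ not (q j))
count-split p q =
  trans (∑-cong (λ j → pointwise (p j) (q j))) (∑-+ (λ j → boolToℕ (p j ∧ q j)) (λ j → boolToℕ (p j ∧ not (q j))))
  where
  pointwise : ∀ a b → boolToℕ a ≡ boolToℕ (a ∧ b) + boolToℕ (a ∧ not b)
  pointwise false b     = refl
  pointwise true  false = refl
  pointwise true  true  = refl

count-≟ : ∀ {N} (x : Fin N) → count (λ j → does (j ≟ x)) ≡ 1
count-≟ {suc N} zero    = cong suc (trans (∑-const N 0) (*-zeroʳ N))
count-≟ {suc N} (suc x) = count-≟ x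

count-remove : ∀ {N} (p : Fin N → Bool) (x : Fin N) → count p ≤ suc (count (λ j → p j ∧ not (does (j ≟ x))))
count-remove p x = begin
  count p                                                                    ≡⟨ count-split p (λ j → does (j ≟ x)) ⟩
  count (λ j → p j ∧ does (j ≟ x)) + count (λ j → p j ∧ not (does (j ≟ x))) ≤⟨ +-monoˡ-≤ _ at-most-x ⟩
  suc (count (λ j → p j ∧ not (does (j ≟ x))))                                ∎
  where
  open ≤-Reasoning
  at-most-x : count (λ j → p j ∧ does (j ≟ x)) ≤ 1
  at-most-x = subst (count (λ j → p j ∧ does (j ≟ x)) ≤_) (count-≟ x) (count-mono (λ j → ∧-trueʳ {p j}))

count-others : ∀ {M} (x : Fin (suc M)) → count (λ j → not (does (j ≟ x))) ≡ M
count-others {M} x = suc-injective (begin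
  suc (count (λ j → not (does (j ≟ x))))                      ≡⟨ cong (_+ count (λ j → not (does (j ≟ x)))) (count-≟ x) ⟨
  count (λ j → does (j ≟ x)) + count (λ j → not (does (j ≟ x))) ≡⟨ count-split (λ _ → true) (λ j → does (j ≟ x)) ⟨
  count {suc M} (λ _ → true)                                  ≡⟨ trans (∑-const (suc M) 1) (*-identityʳ (suc M)) ⟩
  suc M                                                       ∎)
  where open ≡-Reasoning

split-bound : ∀ {a b k x} → k + x ≤ a + b → a < k → x < b
split-bound k+x≤a+b a<k = ≰⇒> (λ b≤x → <⇒≱ (+-mono-<-≤ a<k b≤x) k+x≤a+b)

Distinct : ∀ {N} → (Fin N → Set) → ℕ → Set
Distinct {N} P k = Σ (Fin k → Fin N) λ g → Injective _≡_ _≡_ g × ∀ i → P (g i)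

Distinct-map : ∀ {N k} {P Q : Fin N → Set} → (∀ j → P j → Q j) → Distinct P k → Distinct Q k
Distinct-map P⇒Q (g , g-inj , g-P) = g , g-inj , λ i → P⇒Q (g i) (g-P i)

distinct-from-count : ∀ {N k} (p : Fin N → Bool) → k ≤ count p → Distinct (λ j → p j ≡ true) k
distinct-from-count {k = zero} p _ = (λ ()) , (λ { {()} }) , (λ ())
distinct-from-count {suc N} {suc k} p k<count with p zero in p0
... | true  = prepend (distinct-from-count (p ∘ suc) (≤-pred k<count))
  where
  prepend : Distinct (λ j → p (suc j) ≡ true) k → Distinct (λ j → p j ≡ true) (suc k)
  prepend (g , g-inj , g-p) = zero ∷ (suc ∘ g) , ∷-injective (λ i ()) (g-inj ∘ Fin.suc-injective) , p-g
    where
    p-g : ∀ i → p ((zero ∷ (suc ∘ g)) i) ≡ true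
    p-g zero    = p0
    p-g (suc i) = g-p i
... | false with distinct-from-count (p ∘ suc) k<count
...   | g , g-inj , g-p = suc ∘ g , g-inj ∘ Fin.suc-injective , g-p

double-even : ∀ q → Even (q + q)
double-even q = divides q (trans (cong (q +_) (sym (+-identityʳ q))) (*-comm 2 q))

degree : ∀ {N} → (Fin N → Fin N → Bool) → Fin N → ℕ
degree r x = count (λ y → not (does (y ≟ x)) ∧ r x y)

handshake : ∀ {N} (r : Fin N → Fin N → Bool) → (∀ x y → r x y ≡ r y x) → Even (∑ (degree r))
handshake {zero}  r r-sym = divides 0 refl
handshake {suc N} r r-sym =
  subst (2 ∣_) (sym sum≡) (∣m∣n⇒∣m+n (double-even A) (handshake r′ (λ x y → r-sym (suc x) (suc y))))
  where
  r′ : Fin N → Fin N → Bool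
  r′ x y = r (suc x) (suc y)
  A = count (r zero ∘ suc)
  sum≡ : ∑ (degree r) ≡ (A + A) + ∑ (degree r′)
  sum≡ = begin
    A + ∑ (λ x → boolToℕ (r (suc x) zero) + degree r′ x) ≡⟨ cong (A +_) (∑-+ (boolToℕ ∘ column) (degree r′)) ⟩
    A + (count column + ∑ (degree r′))                   ≡⟨ cong (λ B → A + (B + ∑ (degree r′))) column≡row ⟩
    A + (A + ∑ (degree r′))                              ≡⟨ +-assoc A A _ ⟨
    A + A + ∑ (degree r′)                                ∎
    where
    open ≡-Reasoning
    column : Fin N → Bool
    column x = r (suc x) zero
    column≡row : count column ≡ A
    column≡row = count-cong (λ x → r-sym (suc x) zero)

odd-regular-odd-order : ∀ {N d} (r : Fin N → Fin N → Bool) → (∀ x y → r x y ≡ r y x) →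
  (∀ x → degree r x ≡ d) → Odd N → Odd d → ⊥
odd-regular-odd-order {N} {d} r r-sym regular N-odd d-odd
  with euclidsLemma N d prime[2] (subst (2 ∣_) (trans (∑-cong regular) (∑-const N d)) (handshake r r-sym))
... | inj₁ 2∣N = N-odd 2∣N
... | inj₂ 2∣d = d-odd 2∣d

even⇒odd-suc : ∀ {n} → Even n → Odd (suc n)
even⇒odd-suc {n} 2∣n 2∣suc-n = case ∣1⇒≡1 (∣m+n∣m⇒∣n (subst (2 ∣_) (+-comm 1 n) 2∣suc-n) 2∣n) of λ ()

parity : ∀ n → (Σ ℕ λ q → n ≡ q + q) ⊎ (Σ ℕ λ q → n ≡ suc (q + q))
parity zero = inj₁ (0 , refl)
parity (suc n) with parity n
... | inj₁ (q , n≡) = inj₂ (q , cong suc n≡)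
... | inj₂ (q , n≡) = inj₁ (suc q , cong suc (trans n≡ (sym (+-suc q q))))

even-half : ∀ {n} → Even n → Σ ℕ λ q → n ≡ q + q
even-half {n} 2∣n with parity n
... | inj₁ half = half
... | inj₂ (q , n≡) = ⊥-elim (even⇒odd-suc (double-even q) (subst (2 ∣_) n≡ 2∣n))

odd-half : ∀ {n} → Odd n → Σ ℕ λ q → n ≡ suc (q + q)
odd-half {n} n-odd with parity n
... | inj₁ (q , n≡) = ⊥-elim (n-odd (subst (2 ∣_) (sym n≡) (double-even q)))
... | inj₂ half = half

pigeonhole-ℕ : ∀ {k b} (f : Fin k → ℕ) → Injective _≡_ _≡_ f → (∀ i → f i < b) → k ≤ b
pigeonhole-ℕ f f-inj f<b = Fin.injective⇒≤ {f = λ i → fromℕ< (f<b i)}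
  λ eq → f-inj (trans (sym (Fin.toℕ-fromℕ< _)) (trans (cong toℕ eq) (Fin.toℕ-fromℕ< _)))

pigeonhole-interval : ∀ {k lo w} (f : Fin k → ℕ) → Injective _≡_ _≡_ f → (∀ i → lo ≤ f i × f i < lo + w) → k ≤ w
pigeonhole-interval {lo = lo} {w} f f-inj f∈ = pigeonhole-ℕ (λ i → f i ∸ lo)
  (λ {i} {j} eq → f-inj (∸-cancelʳ-≡ (proj₁ (f∈ i)) (proj₁ (f∈ j)) eq))
  λ i → subst (f i ∸ lo <_) (m+n∸m≡n lo w) (∸-monoˡ-< (proj₂ (f∈ i)) (proj₁ (f∈ i)))

-- Monochromatic stars are fans

ColNbr : (F : Graph) → Coloring F → Bool → Fin (vertices F) → Fin (vertices F) → Set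
ColNbr F c col x y = Adj F x y × c x y ≡ col

Fan : (F : Graph) → Coloring F → Bool → Fin (vertices F) → ℕ → Set
Fan F c col x k = Distinct (ColNbr F c col x) k

module _ {F : Graph} {c : Coloring F} {col : Bool} where

  monoStar⇒fan : ∀ {n} → MonoCopy F c col (Star n) → Σ (Fin (vertices F)) λ x → Fan F c col x n
  monoStar⇒fan (f , f-inj , f-col) =
    f zero , f ∘ suc , Fin.suc-injective ∘ f-inj , λ i → f-col zero (suc i) (inj₁ (refl , λ ()))

  monoStarPlusE⇒fan : ∀ {m} → MonoCopy F c col (StarPlusE m) → Σ (Fin (vertices F)) λ x → Fan F c col x m
  monoStarPlusE⇒fan (f , f-inj , f-col) =
    f zero , f ∘ suc , Fin.suc-injective ∘ f-inj , λ i → f-col zero (suc i) (inj₁ (inj₁ (refl , λ ())))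

  monoStarPlusE⇒triangle : ∀ {m} → MonoCopy F c col (StarPlusE (suc (suc m))) →
    Σ (Fin (vertices F)) λ x → Σ (Fin (vertices F)) λ y → Σ (Fin (vertices F)) λ z →
      c x y ≡ col × c x z ≡ col × c y z ≡ col
  monoStarPlusE⇒triangle (f , _ , f-col) =
    f zero , f (suc zero) , f (suc (suc zero)) ,
    proj₂ (f-col zero (suc zero) (inj₁ (inj₁ (refl , λ ())))) ,
    proj₂ (f-col zero (suc (suc zero)) (inj₁ (inj₁ (refl , λ ())))) ,
    proj₂ (f-col (suc zero) (suc (suc zero)) (inj₂ (inj₁ (refl , refl))))

module Copies (F : Graph)
  (adj-sym : ∀ {i j} → Adj F i j → Adj F j i)
  (adj-irrefl : ∀ {i j} → Adj F i j → i ≢ j)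
  (c : Coloring F) (c-sym : SymmetricColoring F c) where

  ColNbr-sym : ∀ {col x y} → ColNbr F c col x y → ColNbr F c col y x
  ColNbr-sym {x = x} {y} (adj , col) = adj-sym adj , trans (c-sym y x) col

  fan-closed-injective : ∀ {col x k} ((g , _) : Fan F c col x k) → Injective _≡_ _≡_ (x ∷ g)
  fan-closed-injective (g , g-inj , g-nbr) = ∷-injective (λ i → adj-irrefl (proj₁ (g-nbr i)) ∘ sym) g-inj

  fan⇒monoStar : ∀ {col x n} → Fan F c col x n → MonoCopy F c col (Star n)
  fan⇒monoStar {col} {x} fan@(g , _ , g-nbr) = x ∷ g , fan-closed-injective fan , edge
    where
    edge : ∀ i j → StarAdj i j → ColNbr F c col ((x ∷ g) i) ((x ∷ g) j)
    edge zero    zero    (inj₁ (_ , ne))  = ⊥-elim (ne refl)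
    edge zero    zero    (inj₂ (_ , ne))  = ⊥-elim (ne refl)
    edge zero    (suc j) _                = g-nbr j
    edge (suc i) zero    _                = ColNbr-sym (g-nbr i)
    edge (suc i) (suc j) (inj₁ (() , _))
    edge (suc i) (suc j) (inj₂ (() , _))

  triangleFan⇒monoStarPlusE : ∀ {col v w₁ w₂ m} →
    ColNbr F c col v w₁ → ColNbr F c col v w₂ → ColNbr F c col w₁ w₂ →
    Distinct (λ y → ColNbr F c col v y × y ≢ w₁ × y ≢ w₂) m →
    MonoCopy F c col (StarPlusE (suc (suc m)))
  triangleFan⇒monoStarPlusE {col} {v} {w₁} {w₂} {m} vw₁ vw₂ w₁w₂ (g , g-inj , g-nbr) =
    v ∷ leaves , ∷-injective (λ i → adj-irrefl (proj₁ (leaf i)) ∘ sym) leaves-inj , edge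
    where
    leaves = w₁ ∷ w₂ ∷ g
    leaf : ∀ i → ColNbr F c col v (leaves i)
    leaf zero             = vw₁
    leaf (suc zero)       = vw₂
    leaf (suc (suc i))    = proj₁ (g-nbr i)
    leaves-inj : Injective _≡_ _≡_ leaves
    leaves-inj = ∷-injective w₁∉ (∷-injective (proj₂ ∘ proj₂ ∘ g-nbr) g-inj)
      where
      w₁∉ : ∀ i → (w₂ ∷ g) i ≢ w₁
      w₁∉ zero    = adj-irrefl (proj₁ w₁w₂) ∘ sym
      w₁∉ (suc i) = proj₁ (proj₂ (g-nbr i))
    edge : ∀ i j → Adj (StarPlusE (suc (suc m))) i j → ColNbr F c col ((v ∷ leaves) i) ((v ∷ leaves) j)
    edge zero    zero    (inj₁ (inj₁ (_ , ne))) = ⊥-elim (ne refl)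
    edge zero    zero    (inj₁ (inj₂ (_ , ne))) = ⊥-elim (ne refl)
    edge zero    (suc j) (inj₁ _)               = leaf j
    edge (suc i) zero    (inj₁ _)               = ColNbr-sym (leaf i)
    edge (suc i) (suc j) (inj₁ (inj₁ (() , _)))
    edge (suc i) (suc j) (inj₁ (inj₂ (() , _)))
    edge i j (inj₂ (inj₁ (i≡1 , j≡2)))
      rewrite Fin.toℕ-injective {i = i} {suc zero} i≡1 | Fin.toℕ-injective {i = j} {suc (suc zero)} j≡2 = w₁w₂
    edge i j (inj₂ (inj₂ (i≡2 , j≡1)))
      rewrite Fin.toℕ-injective {i = i} {suc (suc zero)} i≡2 | Fin.toℕ-injective {i = j} {suc zero} j≡1 = ColNbr-sym w₁w₂

  redStar⊎blueStarPlusE : ∀ {n m v u} → ColNbr F c false v u → (P Q : Fin (vertices F) → Bool) →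
    (∀ j → P j ≡ true → ColNbr F c false v j × j ≢ u) →
    (∀ j → Q j ≡ true → P j ≡ true × Adj F u j) →
    suc m ≤ count P → n ≤ count Q →
    MonoCopy F c true (Star n) ⊎ MonoCopy F c false (StarPlusE (suc (suc m)))
  redStar⊎blueStarPlusE {n} {m} {v} {u} vu P Q P-blue Q-adj P-big Q-big with n ≤? count (λ j → Q j ∧ c u j)
  ... | yes many-red = inj₁ (fan⇒monoStar (Distinct-map red (distinct-from-count _ many-red)))
    where
    red : ∀ j → (Q j ∧ c u j) ≡ true → ColNbr F c true u j
    red j e = proj₂ (Q-adj j (∧-trueˡ e)) , ∧-trueʳ e
  ... | no few-red with distinct-from-count (λ j → Q j ∧ not (c u j)) (split-bound Q-split (≰⇒> few-red))
    where
    Q-split : n + 0 ≤ count (λ j → Q j ∧ c u j) + count (λ j → Q j ∧ not (c u j))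
    Q-split = subst₂ _≤_ (sym (+-identityʳ n)) (count-split Q (c u)) Q-big
  ... | g , _ , g-blue = inj₂ (triangleFan⇒monoStarPlusE vu vw uw (Distinct-map rest (distinct-from-count P′ P′-big)))
    where
    w = g zero
    Qw = Q-adj w (∧-trueˡ (g-blue zero))
    vw = proj₁ (P-blue w (proj₁ Qw))
    uw : ColNbr F c false u w
    uw = proj₂ Qw , not-true (∧-trueʳ (g-blue zero))
    P′ : Fin (vertices F) → Bool
    P′ j = P j ∧ not (does (j ≟ w))
    P′-big : m ≤ count P′
    P′-big = ≤-pred (≤-trans P-big (count-remove P w))
    rest : ∀ j → P′ j ≡ true → ColNbr F c false v j × j ≢ u × j ≢ w
    rest j e = proj₁ (P-blue j (∧-trueˡ e)) , proj₂ (P-blue j (∧-trueˡ e)) , not-≟⇒≢ (∧-trueʳ e)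

-- Star-critical Ramsey numbers from two bounds

record Embedding (F F′ : Graph) : Set where
  constructor embedding
  field
    map       : Fin (vertices F) → Fin (vertices F′)
    injective : Injective _≡_ _≡_ map
    adjacent  : ∀ i j → Adj F i j → Adj F′ (map i) (map j)

pullback : ∀ {F F′} → Embedding F F′ → Coloring F′ → Coloring F
pullback e c′ i j = c′ (Embedding.map e i) (Embedding.map e j)

embed-copy : ∀ {F F′ G col} (e : Embedding F F′) (c′ : Coloring F′) →
  MonoCopy F (pullback e c′) col G → MonoCopy F′ c′ col G
embed-copy (embedding e e-inj e-adj) c′ (f , f-inj , f-col) =
  e ∘ f , f-inj ∘ e-inj , λ i j a → e-adj (f i) (f j) (proj₁ (f-col i j a)) , proj₂ (f-col i j a)

arrows-embedding : ∀ {F F′ G H} → Embedding F F′ → Arrows F G H → Arrows F′ G H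
arrows-embedding e arrows c′ c′-sym with arrows (pullback e c′) (λ i j → c′-sym (Embedding.map e i) (Embedding.map e j))
... | inj₁ red  = inj₁ (embed-copy e c′ red)
... | inj₂ blue = inj₂ (embed-copy e c′ blue)

KSqStar-sym : ∀ {M k} {i j : Fin (suc M)} → Adj (KSqStar M k) i j → Adj (KSqStar M k) j i
KSqStar-sym (i≢j , i-hub , j-hub) = i≢j ∘ sym , j-hub , i-hub

KSqStar↪K : ∀ M k → Embedding (KSqStar M k) (K (suc M))
KSqStar↪K M k = embedding (λ i → i) (λ eq → eq) (λ i j → proj₁)

KSqStar-mono : ∀ {M j k} → j ≤ k → Embedding (KSqStar M j) (KSqStar M k)
KSqStar-mono j≤k = embedding (λ i → i) (λ eq → eq)
  λ { i j (i≢j , i-hub , j-hub) → i≢j , (λ z → ≤-trans (i-hub z) j≤k) , (λ z → ≤-trans (j-hub z) j≤k) }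

K↪KSqStar : ∀ {M′ M} k → M′ ≤ M → Embedding (K M′) (KSqStar M k)
K↪KSqStar k M′≤M = embedding (suc ∘ (λ i → inject≤ i M′≤M)) (Fin.inject≤-injective _ _ _ _ ∘ Fin.suc-injective)
  λ i j i≢j → i≢j ∘ Fin.inject≤-injective _ _ _ _ ∘ Fin.suc-injective , (λ ()) , (λ ())

starCritical : ∀ {G H M k} → 1 ≤ k → Arrows (KSqStar M k) G H → ¬ Arrows (KSqStar M (k ∸ 1)) G H →
  IsStarCriticalRamseyNumber G H k
starCritical {G} {H} {M} {k} 1≤k arrows ¬arrows =
  M , (s≤s z≤n , arrows-embedding (KSqStar↪K M k) arrows ,
       λ M′ _ M′<suc-M arrows′ → ¬arrows (arrows-embedding (K↪KSqStar (k ∸ 1) (≤-pred M′<suc-M)) arrows′)) ,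
  1≤k , arrows ,
  λ j _ j<k arrows′ → ¬arrows (arrows-embedding (KSqStar-mono (j≤k∸1 j<k)) arrows′)
  where
  j≤k∸1 : ∀ {j} → j < k → j ≤ k ∸ 1
  j≤k∸1 {j} j<k = subst (j ≤_) (pred[m∸n]≡m∸[1+n] k 0) (<⇒≤pred j<k)

-- Upper bounds

module Host {M k : ℕ} (c : Coloring (KSqStar M k)) (c-sym : SymmetricColoring (KSqStar M k) c) where
  open Copies (KSqStar M k) KSqStar-sym proj₁ c c-sym public

  Full : Fin (suc M) → Set
  Full v = ∀ j → j ≢ v → Adj (KSqStar M k) v j

  redNbrs blueNbrs : Fin (suc M) → Fin (suc M) → Bool
  redNbrs  v j = not (does (j ≟ v)) ∧ c v j
  blueNbrs v j = not (does (j ≟ v)) ∧ not (c v j)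

  blueNbrsExcept : Fin (suc M) → Fin (suc M) → Fin (suc M) → Bool
  blueNbrsExcept v u j = blueNbrs v j ∧ not (does (j ≟ u))

  red+blue : ∀ v → count (redNbrs v) + count (blueNbrs v) ≡ M
  red+blue v = trans (sym (count-split (λ j → not (does (j ≟ v))) (c v))) (count-others v)

  redNbr : ∀ {v} → Full v → ∀ j → redNbrs v j ≡ true → ColNbr (KSqStar M k) c true v j
  redNbr full j e = full j (not-≟⇒≢ (∧-trueˡ e)) , ∧-trueʳ e

  blueNbr : ∀ {v} → Full v → ∀ j → blueNbrs v j ≡ true → ColNbr (KSqStar M k) c false v j
  blueNbr full j e = full j (not-≟⇒≢ (∧-trueˡ e)) , not-true (∧-trueʳ e)

  blueNbrExcept : ∀ {v u} → Full v → ∀ j → blueNbrsExcept v u j ≡ true → ColNbr (KSqStar M k) c false v j × j ≢ u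
  blueNbrExcept full j e = blueNbr full j (∧-trueˡ e) , not-≟⇒≢ (∧-trueʳ e)

  blueNbrsExcept-count : ∀ v u {x} → x < count (blueNbrs v) → x ≤ count (blueNbrsExcept v u)
  blueNbrsExcept-count v u many = ≤-pred (≤-trans many (count-remove (blueNbrs v) u))

  redStar⊎manyBlue : ∀ {n x v} → Full v → n + x ≡ M →
    MonoCopy (KSqStar M k) c true (Star n) ⊎ x < count (blueNbrs v)
  redStar⊎manyBlue {n} {x} {v} full n+x≡M with n ≤? count (redNbrs v)
  ... | yes many-red = inj₁ (fan⇒monoStar (Distinct-map (redNbr full) (distinct-from-count (redNbrs v) many-red)))
  ... | no few-red   = inj₂ (split-bound (≤-reflexive (trans n+x≡M (sym (red+blue v)))) (≰⇒> few-red))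

  fullPair-redStar⊎blueStarPlusE : ∀ {n m v u} → Full v → Full u → ColNbr (KSqStar M k) c false v u →
    suc m < count (blueNbrs v) → n < count (blueNbrs v) →
    MonoCopy (KSqStar M k) c true (Star n) ⊎ MonoCopy (KSqStar M k) c false (StarPlusE (suc (suc m)))
  fullPair-redStar⊎blueStarPlusE {v = v} {u} v-full u-full vu m-many n-many =
    redStar⊎blueStarPlusE vu (blueNbrsExcept v u) (blueNbrsExcept v u) (blueNbrExcept v-full)
      (λ j e → e , u-full j (proj₂ (blueNbrExcept v-full j e)))
      (blueNbrsExcept-count v u m-many) (blueNbrsExcept-count v u n-many)

arrows-odd : ∀ {n m′} → n ≤ m′ → Arrows (KSqStar (suc (n + m′)) 1) (Star n) (StarPlusE (suc (suc m′)))
arrows-odd {n} {m′} n≤m′ c c-sym = proceed (redStar⊎manyBlue v-full (+-suc n m′))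
  where
  open Host c c-sym
  V = suc (suc (n + m′))
  v : Fin V
  v = suc zero
  v-full : Full v
  v-full j j≢v = j≢v ∘ sym , (λ ()) , (λ _ → s≤s z≤n)
  proceed : _ ⊎ suc m′ < count (blueNbrs v) → _
  proceed (inj₁ red-star)  = inj₁ red-star
  proceed (inj₂ many-blue) = redStar⊎blueStarPlusE vu P Q (blueNbrExcept v-full) Q-adj P-big
    (≤-trans n≤m′ (≤-pred (≤-trans P-big (count-remove P zero))))
    where
    off-hub : ∀ {j} → not (does (j ≟ zero)) ≡ true → toℕ j ≢ 0
    off-hub e j≡0 = not-≟⇒≢ e (Fin.toℕ-injective j≡0)
    u-choice = distinct-from-count {k = 1} (blueNbrsExcept v zero) (≤-trans (s≤s z≤n) (blueNbrsExcept-count v zero many-blue))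
    u = proj₁ u-choice zero
    u-blue = proj₂ (proj₂ u-choice) zero
    vu = proj₁ (blueNbrExcept v-full u u-blue)
    P Q : Fin V → Bool
    P = blueNbrsExcept v u
    Q j = P j ∧ not (does (j ≟ zero))
    P-big : suc m′ ≤ count P
    P-big = blueNbrsExcept-count v u many-blue
    Q-adj : ∀ j → Q j ≡ true → P j ≡ true × Adj (KSqStar (suc (n + m′)) 1) u j
    Q-adj j e = ∧-trueˡ e , proj₂ (blueNbrExcept v-full j (∧-trueˡ e)) ∘ sym ,
                ⊥-elim ∘ off-hub (∧-trueʳ u-blue) , ⊥-elim ∘ off-hub (∧-trueʳ e)

arrows-large : ∀ {n m′} → m′ < n → Arrows (KSqStar (n + n) (suc n)) (Star n) (StarPlusE (suc (suc m′)))
arrows-large {suc n′} {m′} (s≤s m′≤n′) c c-sym = proceed (Fin.any? (λ i → c v (low i) Bool.≟ false))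
  where
  open Host c c-sym
  n = suc n′
  V = suc (n + n)
  v : Fin V
  v = suc zero
  v-full : Full v
  v-full j j≢v = j≢v ∘ sym , (λ ()) , (λ _ → s≤s z≤n)
  low : Fin n → Fin V
  low i = suc (suc (inject≤ i (m≤n+m n n′)))
  low-injective : Injective _≡_ _≡_ low
  low-injective = Fin.inject≤-injective _ _ _ _ ∘ Fin.suc-injective ∘ Fin.suc-injective
  low-full : ∀ i → Full (low i)
  low-full i j j≢low = j≢low ∘ sym , (λ ()) , λ _ → subst (_≤ suc n) (cong (λ t → suc (suc t)) (sym toℕ-low)) (s≤s (s≤s (Fin.toℕ≤pred[n] i)))
    where toℕ-low = Fin.toℕ-inject≤ i (m≤n+m n n′)
  proceed : Dec (Σ (Fin n) λ i → c v (low i) ≡ false) → _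
  proceed (no all-red) =
    inj₁ (fan⇒monoStar (low , low-injective , λ i → v-full (low i) (λ ()) , Bool.¬-not (all-red ∘ (i ,_))))
  proceed (yes (i , vu-blue)) with redStar⊎manyBlue v-full refl
  ... | inj₁ red-star  = inj₁ red-star
  ... | inj₂ many-blue = fullPair-redStar⊎blueStarPlusE v-full (low-full i) (v-full (low i) (λ ()) , vu-blue)
                           (≤-<-trans (s≤s m′≤n′) many-blue) many-blue

arrows-even : ∀ {n₁ m′} → suc n₁ ≤ m′ → Odd n₁ → Even (suc n₁ + m′) →
  Arrows (KSqStar (suc n₁ + m′) (suc n₁ + m′)) (Star (suc n₁)) (StarPlusE (suc (suc m′)))
arrows-even {n₁} {m′} n≤m′ n₁-odd M-even c c-sym =
  proceed (Fin.any? λ v → suc n₁ ≤? count (redNbrs v)) (Fin.any? λ v → suc (suc m′) ≤? count (blueNbrs v))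
  where
  open Host c c-sym
  M = suc n₁ + m′
  full : ∀ v → Full v
  full v j j≢v = j≢v ∘ sym , (λ _ → Fin.toℕ≤pred[n] j) , (λ _ → Fin.toℕ≤pred[n] v)
  proceed : Dec (Σ (Fin (suc M)) λ v → suc n₁ ≤ count (redNbrs v)) →
            Dec (Σ (Fin (suc M)) λ v → suc (suc m′) ≤ count (blueNbrs v)) →
            MonoCopy (KSqStar M M) c true (Star (suc n₁)) ⊎ MonoCopy (KSqStar M M) c false (StarPlusE (suc (suc m′)))
  proceed (yes (v , many-red)) _ =
    inj₁ (fan⇒monoStar (Distinct-map (redNbr (full v)) (distinct-from-count (redNbrs v) many-red)))
  proceed (no _) (yes (v , many-blue)) =
    fullPair-redStar⊎blueStarPlusE (full v) (full u) (blueNbr (full v) u (proj₂ (proj₂ u-choice) zero))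
      many-blue (≤-trans (s≤s (m≤n⇒m≤1+n n≤m′)) many-blue)
    where
    u-choice = distinct-from-count {k = 1} (blueNbrs v) (≤-trans (s≤s z≤n) many-blue)
    u = proj₁ u-choice zero
  -- every red degree is then exactly n₁, which is odd, on an odd number of vertices
  proceed (no few-red) (no few-blue) = ⊥-elim (odd-regular-odd-order c c-sym regular (even⇒odd-suc M-even) n₁-odd)
    where
    regular : ∀ v → degree c v ≡ n₁
    regular v = ≤-antisym red≤n₁ (≮⇒≥ λ red<n₁ → few-blue (v , split-bound (≤-reflexive split) red<n₁))
      where
      red≤n₁ = ≤-pred (≰⇒> (few-red ∘ (v ,_)))
      split : n₁ + suc m′ ≡ count (redNbrs v) + count (blueNbrs v)
      split = trans (+-suc n₁ m′) (sym (red+blue v))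

-- Lower bounds

fanFree⇒¬arrows : ∀ {F n m} (c : Coloring F) → SymmetricColoring F c →
  (∀ x → ¬ Fan F c true x n) → (∀ x → ¬ Fan F c false x m) → ¬ Arrows F (Star n) (StarPlusE m)
fanFree⇒¬arrows {F} c c-sym no-red no-blue arrows with arrows c c-sym
... | inj₁ red  = let x , fan = monoStar⇒fan {F} {c} red in no-red x fan
... | inj₂ blue = let x , fan = monoStarPlusE⇒fan {F} {c} blue in no-blue x fan

module Bipartite (n′ : ℕ) where
  n = suc n′
  F = KSqStar (n + n) n

  left : ℕ → Bool
  left zero    = false
  left (suc a) = does (a <? n)

  colour : Coloring F
  colour y z = does (left (toℕ y) Bool.≟ left (toℕ z))

  colour-sym : SymmetricColoring F colour
  colour-sym y z = does-⇔ (mk⇔ sym sym) (left (toℕ y) Bool.≟ left (toℕ z)) (left (toℕ z) Bool.≟ left (toℕ y))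

  left-true : ∀ {t} → left t ≡ true → 1 ≤ t × t < 1 + n
  left-true {suc a} e = s≤s z≤n , s≤s (does-true (a <? n) e)

  left-false : ∀ {t} → left t ≡ false → t ≢ 0 → n < t
  left-false {zero}  _ t≢0 = ⊥-elim (t≢0 refl)
  left-false {suc a} e _   = s≤s (≮⇒≥ (does-false (a <? n) e))

  open Copies F KSqStar-sym proj₁ colour colour-sym using (fan-closed-injective)

  same-side : ∀ {x k} ((g , _) : Fan F colour true x k) → ∀ i → left (toℕ ((x ∷ g) i)) ≡ left (toℕ x)
  same-side _            zero    = refl
  same-side (_ , _ , g-red) (suc i) = sym (does-true (_ Bool.≟ _) (proj₂ (g-red i)))

  ¬redFan : ∀ x → ¬ Fan F colour true x n
  ¬redFan zero (g , _ , g-red) with toℕ (g zero) in g≡ | g-red zero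
  ... | zero  | (hub≢g , _) , _   = hub≢g (Fin.toℕ-injective (sym g≡))
  ... | suc b | (_ , g-near , _) , same = <⇒≱ (left-false (sym (does-true (_ Bool.≟ _) same)) λ ()) (g-near refl)
  ¬redFan x@(suc x′) fan@(g , _ , g-red) = by-side (left (toℕ x)) refl
    where
    closed-injective : Injective _≡_ _≡_ (toℕ ∘ (x ∷ g))
    closed-injective eq = fan-closed-injective fan (Fin.toℕ-injective eq)
    by-side : ∀ b → left (toℕ x) ≡ b → ⊥
    by-side true  left-x = 1+n≰n (pigeonhole-interval (toℕ ∘ (x ∷ g)) closed-injective
                                   λ i → left-true (trans (same-side fan i) left-x))
    by-side false left-x = 1+n≰n (pigeonhole-interval (toℕ ∘ (x ∷ g)) closed-injective
                                   λ i → left-false (trans (same-side fan i) left-x) (off-hub i) , Fin.toℕ<n ((x ∷ g) i))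
      where
      off-hub : ∀ i → toℕ ((x ∷ g) i) ≢ 0
      off-hub zero    ()
      off-hub (suc i) leaf≡0 = <⇒≱ (left-false left-x λ ()) (proj₂ (proj₂ (proj₁ (g-red i))) leaf≡0)

  ¬blueStarPlusE : ∀ {m} → ¬ MonoCopy F colour false (StarPlusE (suc (suc m)))
  ¬blueStarPlusE copy with monoStarPlusE⇒triangle {F} {colour} copy
  ... | x , y , z , xy , xz , yz = two-sides (blue x y xy) (blue x z xz) (blue y z yz)
    where
    blue : ∀ a b → colour a b ≡ false → left (toℕ a) ≢ left (toℕ b)
    blue a b = does-false (left (toℕ a) Bool.≟ left (toℕ b))
    two-sides : ∀ {a b c : Bool} → a ≢ b → a ≢ c → b ≢ c → ⊥
    two-sides {false} {false}         ab _  _  = ab refl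
    two-sides {true}  {true}          ab _  _  = ab refl
    two-sides {false} {true}  {false} _  ac _  = ac refl
    two-sides {true}  {false} {true}  _  ac _  = ac refl
    two-sides {false} {true}  {true}  _  _  bc = bc refl
    two-sides {true}  {false} {false} _  _  bc = bc refl

  ¬arrows : ∀ {m} → ¬ Arrows F (Star n) (StarPlusE (suc (suc m)))
  ¬arrows arrows with arrows colour colour-sym
  ... | inj₁ red  = let x , fan = monoStar⇒fan {F} {colour} red in ¬redFan x fan
  ... | inj₂ blue = ¬blueStarPlusE blue

∣-∣≡⇒≡+ : ∀ {a b d} → a ≤ b → ∣ a - b ∣ ≡ d → b ≡ a + d
∣-∣≡⇒≡+ {a} a≤b eq = trans (sym (m+[n∸m]≡n a≤b)) (cong (a +_) (trans (sym (m≤n⇒∣m-n∣≡n∸m a≤b)) eq))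

module _ {N : ℕ} .{{_ : NonZero N}} where

  %-wrap : ∀ {m} → N ≤ m → m < N + N → m % N ≡ m ∸ N
  %-wrap {m} N≤m m<2N = begin
    m % N       ≡⟨ m≤n⇒[n∸m]%m≡n%m N≤m ⟨
    (m ∸ N) % N ≡⟨ m<n⇒m%n≡m (+-cancelʳ-< N (m ∸ N) N (subst (_< N + N) (sym (m∸n+n≡m N≤m)) m<2N)) ⟩
    m ∸ N       ∎
    where open ≡-Reasoning

  private
    unwrapped≢wrapped : ∀ {x y z} → x + z < N → N ≤ y + z → y < N → z < N → (x + z) % N ≢ (y + z) % N
    unwrapped≢wrapped {x} {y} {z} x+z<N N≤y+z y<N z<N eq =
      <-irrefl wrapped≡ (≤-trans (+-cancelʳ-< N (y + z ∸ N) z lt) (m≤n+m z x))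
      where
      wrapped≡ : y + z ∸ N ≡ x + z
      wrapped≡ = trans (sym (%-wrap N≤y+z (+-mono-< y<N z<N))) (trans (sym eq) (m<n⇒m%n≡m x+z<N))
      lt : y + z ∸ N + N < z + N
      lt = subst₂ _<_ (sym (m∸n+n≡m N≤y+z)) (+-comm N z) (+-monoˡ-< z y<N)

    +-%-injective-< : ∀ {x y z} → x < N → y < N → z < N → (x + z) % N ≡ (y + z) % N → x ≡ y
    +-%-injective-< {x} {y} {z} x<N y<N z<N eq with x + z <? N | y + z <? N
    ... | yes p | yes q = +-cancelʳ-≡ z x y (trans (sym (m<n⇒m%n≡m p)) (trans eq (m<n⇒m%n≡m q)))
    ... | no ¬p | no ¬q = +-cancelʳ-≡ z x y (∸-cancelʳ-≡ (≮⇒≥ ¬p) (≮⇒≥ ¬q)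
            (trans (sym (%-wrap (≮⇒≥ ¬p) (+-mono-< x<N z<N))) (trans eq (%-wrap (≮⇒≥ ¬q) (+-mono-< y<N z<N)))))
    ... | yes p | no ¬q = ⊥-elim (unwrapped≢wrapped p (≮⇒≥ ¬q) y<N z<N eq)
    ... | no ¬p | yes q = ⊥-elim (unwrapped≢wrapped q (≮⇒≥ ¬p) x<N z<N (sym eq))

  +-%-injective : ∀ {x y} z → x < N → y < N → (x + z) % N ≡ (y + z) % N → x ≡ y
  +-%-injective {x} {y} z x<N y<N eq = +-%-injective-< x<N y<N (m%n<n z N)
    (trans (sym (reduce x<N)) (trans eq (reduce y<N)))
    where
    reduce : ∀ {x} → x < N → (x + z) % N ≡ (x + z % N) % N
    reduce {x} x<N = trans (%-distribˡ-+ x z N) (cong (λ t → (t + z % N) % N) (m<n⇒m%n≡m x<N))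

module Circulant (N h : ℕ) .{{_ : NonZero N}} (h+h<N : h + h < N) where

  Near : ℕ → Set
  Near δ = δ ≤ h ⊎ N ≤ δ + h

  near-complement : ∀ {δ δ′} → δ + δ′ ≡ N → Near δ → Near δ′
  near-complement {δ} {δ′} eq (inj₁ δ≤h)   = inj₂ (subst₂ _≤_ eq (+-comm h δ′) (+-monoˡ-≤ δ′ δ≤h))
  near-complement {δ} {δ′} eq (inj₂ N≤δ+h) = inj₁ (+-cancelˡ-≤ δ δ′ h (subst (_≤ δ + h) (sym eq) N≤δ+h))

  offset : ℕ → ℕ → ℕ
  offset a b = (b + (N ∸ a)) % N

  offset<N : ∀ a b → offset a b < N
  offset<N a b = m%n<n (b + (N ∸ a)) N

  offset-injective : ∀ a {b b′} → b < N → b′ < N → offset a b ≡ offset a b′ → b ≡ b′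
  offset-injective a = +-%-injective (N ∸ a)

  offset-distance : ∀ {a b} → a < N → b < N → ∣ a - b ∣ ≡ offset a b ⊎ ∣ a - b ∣ + offset a b ≡ N
  offset-distance {a} {b} a<N b<N with a ≤? b
  ... | yes a≤b = inj₁ (begin
    ∣ a - b ∣         ≡⟨ m≤n⇒∣m-n∣≡n∸m a≤b ⟩
    b ∸ a             ≡⟨ m<n⇒m%n≡m (≤-<-trans (m∸n≤m b a) b<N) ⟨
    (b ∸ a) % N       ≡⟨ [m+n]%n≡m%n (b ∸ a) N ⟨
    (b ∸ a + N) % N   ≡⟨ cong (_% N) (+-∸-comm N a≤b) ⟨
    (b + N ∸ a) % N   ≡⟨ cong (_% N) (+-∸-assoc b (<⇒≤ a<N)) ⟩
    offset a b        ∎)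
    where open ≡-Reasoning
  ... | no a≰b = inj₂ (begin
    ∣ a - b ∣ + offset a b  ≡⟨ cong₂ _+_ (m≤n⇒∣n-m∣≡n∸m b≤a) (m<n⇒m%n≡m wrapless) ⟩
    a ∸ b + (b + (N ∸ a))   ≡⟨ +-assoc (a ∸ b) b (N ∸ a) ⟨
    a ∸ b + b + (N ∸ a)     ≡⟨ cong (_+ (N ∸ a)) (m∸n+n≡m b≤a) ⟩
    a + (N ∸ a)             ≡⟨ m+[n∸m]≡n (<⇒≤ a<N) ⟩
    N                       ∎)
    where
    open ≡-Reasoning
    b≤a = <⇒≤ (≰⇒> a≰b)
    wrapless : b + (N ∸ a) < N
    wrapless = subst (b + (N ∸ a) <_) (m+[n∸m]≡n (<⇒≤ a<N)) (+-monoˡ-< (N ∸ a) (≰⇒> a≰b))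

  near-offset : ∀ {a b} → a < N → b < N → Near ∣ a - b ∣ → Near (offset a b)
  near-offset a<N b<N near with offset-distance a<N b<N
  ... | inj₁ eq = subst Near eq near
  ... | inj₂ eq = near-complement eq near

  offset-near : ∀ {a b} → a < N → b < N → Near (offset a b) → Near ∣ a - b ∣
  offset-near {a} {b} a<N b<N near with offset-distance a<N b<N
  ... | inj₁ eq = subst Near (sym eq) near
  ... | inj₂ eq = near-complement (trans (+-comm (offset a b) ∣ a - b ∣) eq) near

  private
    h<N : h < N
    h<N = ≤-<-trans (m≤m+n h h) h+h<N

  rot : ℕ → ℕ
  rot e = (e + h) % N

  rot-near : ∀ {e} → e < N → Near e → rot e ≤ h + h
  rot-near {e} e<N (inj₁ e≤h) = subst (_≤ h + h) (sym (m<n⇒m%n≡m (≤-<-trans e+h≤h+h h+h<N))) e+h≤h+h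
    where e+h≤h+h = +-monoˡ-≤ h e≤h
  rot-near {e} e<N (inj₂ N≤e+h) = subst (_≤ h + h) (sym (%-wrap N≤e+h (+-mono-< e<N h<N)))
    (≤-trans (subst (e + h ∸ N ≤_) (m+n∸m≡n N h) (∸-monoˡ-≤ N (+-monoˡ-≤ h (<⇒≤ e<N)))) (m≤m+n h h))

  rot-far : ∀ {e} → ¬ Near e → h + h < rot e
  rot-far {e} far = subst (h + h <_) (sym (m<n⇒m%n≡m (≰⇒> (far ∘ inj₂)))) (+-monoˡ-< h (≰⇒> (far ∘ inj₁)))

  -- the position of b seen from a, shifted by h so that the points near a fill 0, …, 2h
  slot : ℕ → ℕ → ℕ
  slot a b = rot (offset a b)

  slot<N : ∀ a b → slot a b < N
  slot<N a b = m%n<n (offset a b + h) N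

  slot-injective : ∀ a {b b′} → b < N → b′ < N → slot a b ≡ slot a b′ → b ≡ b′
  slot-injective a b<N b′<N eq = offset-injective a b<N b′<N (+-%-injective h (offset<N a _) (offset<N a _) eq)

  slot-near : ∀ {a b} → a < N → b < N → Near ∣ a - b ∣ → slot a b ≤ h + h
  slot-near {a} {b} a<N b<N near = rot-near (offset<N a b) (near-offset a<N b<N near)

  slot-far : ∀ {a b} → a < N → b < N → ¬ Near ∣ a - b ∣ → h + h < slot a b
  slot-far a<N b<N far = rot-far (far ∘ offset-near a<N b<N)

  module Antipodes (K : ℕ) (N≡K+K : N ≡ K + K) (h<K : h < K) where

    private
      K<N : K < N
      K<N = subst (K <_) (sym N≡K+K) (m<m+n K (≤-<-trans z≤n h<K))

      rot-K : rot K ≡ K + h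
      rot-K = m<n⇒m%n≡m (subst (K + h <_) (sym N≡K+K) (+-monoʳ-< K h<K))

      complement-K : ∀ {δ} → K + δ ≡ N → δ ≡ K
      complement-K eq = +-cancelˡ-≡ K _ K (trans eq N≡K+K)

    slot-antipodal : ∀ {a b} → a < N → b < N → ∣ a - b ∣ ≡ K → slot a b ≡ K + h
    slot-antipodal {a} {b} a<N b<N δ≡K = trans (cong rot offset≡K) rot-K
      where
      offset≡K : offset a b ≡ K
      offset≡K with offset-distance a<N b<N
      ... | inj₁ eq = trans (sym eq) δ≡K
      ... | inj₂ eq = complement-K (subst (λ δ → δ + offset a b ≡ N) δ≡K eq)

    antipodal-slot : ∀ {a b} → a < N → b < N → slot a b ≡ K + h → ∣ a - b ∣ ≡ K
    antipodal-slot {a} {b} a<N b<N eq = distance≡K (offset-distance a<N b<N)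
      where
      offset≡K : offset a b ≡ K
      offset≡K = +-%-injective h (offset<N a b) K<N (trans eq (sym rot-K))
      distance≡K : ∣ a - b ∣ ≡ offset a b ⊎ ∣ a - b ∣ + offset a b ≡ N → ∣ a - b ∣ ≡ K
      distance≡K (inj₁ δ≡offset)   = trans δ≡offset offset≡K
      distance≡K (inj₂ δ+offset≡N) = complement-K (trans (+-comm K _) (subst (λ e → ∣ a - b ∣ + e ≡ N) offset≡K δ+offset≡N))

  near? : ∀ δ → Dec (Near δ)
  near? δ = (δ ≤? h) ⊎-dec (N ≤? δ + h)

  -- untwisted: red edges join points at circular distance ≤ h.  twisted (N = 2K): the antipodal
  -- pairs avoiding S are red as well, and the hub is red exactly to the points of S.
  data Twist : Set₁ where
    untwisted : Twist
    twisted   : (K : ℕ) → N ≡ K + K → h < K → (S : ℕ → Set) → Decidable S → Twist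

  Hub : Twist → ℕ → Set
  Hub untwisted           _ = ⊥
  Hub (twisted _ _ _ S _)   = S

  hub? : ∀ t → Decidable (Hub t)
  hub? untwisted            _ = no (λ ())
  hub? (twisted _ _ _ _ S?)   = S?

  Antipodal : Twist → ℕ → Set
  Antipodal untwisted           _ = ⊥
  Antipodal (twisted K _ _ _ _) δ = δ ≡ K

  antipodal? : ∀ t → Decidable (Antipodal t)
  antipodal? untwisted           _ = no (λ ())
  antipodal? (twisted K _ _ _ _) δ = δ ℕ.≟ K

  extra : Twist → ℕ
  extra untwisted           = 0
  extra (twisted _ _ _ _ _) = 1

  antipode-unique : ∀ t {a b b′} → a < N → b < N → b′ < N →
    Antipodal t ∣ a - b ∣ → Antipodal t ∣ a - b′ ∣ → b ≡ b′
  antipode-unique (twisted K N≡K+K h<K _ _) {a} a<N b<N b′<N δ≡K δ′≡K =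
    slot-injective a b<N b′<N (trans (slot-antipodal a<N b<N δ≡K) (sym (slot-antipodal a<N b′<N δ′≡K)))
    where open Antipodes K N≡K+K h<K

  extra-antipodal : ∀ t {δ} → Antipodal t δ → extra t ≡ 1
  extra-antipodal (twisted _ _ _ _ _) _ = refl

  extra-hub : ∀ t {a} → Hub t a → extra t ≡ 1
  extra-hub (twisted _ _ _ _ _) _ = refl

  -- vertex suc a of KSqStar N k is the point a of ℤ/N, vertex 0 is the hub
  module Colouring (t : Twist) (k : ℕ) where

    F : Graph
    F = KSqStar N k

    data Red : ℕ → ℕ → Set where
      near      : ∀ {a b} → Near ∣ a - b ∣ → Red (suc a) (suc b)
      antipodal : ∀ {a b} → Antipodal t ∣ a - b ∣ → ¬ Hub t a → ¬ Hub t b → Red (suc a) (suc b)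
      hub-rim   : ∀ {b} → Hub t b → Red 0 (suc b)
      rim-hub   : ∀ {a} → Hub t a → Red (suc a) 0

    red? : ∀ s u → Dec (Red s u)
    red? zero    zero    = no (λ ())
    red? zero    (suc b) = map′ hub-rim (λ { (hub-rim p) → p }) (hub? t b)
    red? (suc a) zero    = map′ rim-hub (λ { (rim-hub p) → p }) (hub? t a)
    red? (suc a) (suc b) = map′ [ near , (λ (p , ¬a , ¬b) → antipodal p ¬a ¬b) ]′
      (λ { (near p) → inj₁ p ; (antipodal p ¬a ¬b) → inj₂ (p , ¬a , ¬b) })
      (near? ∣ a - b ∣ ⊎-dec (antipodal? t ∣ a - b ∣ ×-dec (¬? (hub? t a) ×-dec ¬? (hub? t b))))

    Red-sym : ∀ {s u} → Red s u → Red u s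
    Red-sym {suc a} {suc b} (near p)            = near (subst Near (∣-∣-comm a b) p)
    Red-sym {suc a} {suc b} (antipodal p ¬a ¬b) = antipodal (subst (Antipodal t) (∣-∣-comm a b) p) ¬b ¬a
    Red-sym (hub-rim p) = rim-hub p
    Red-sym (rim-hub p) = hub-rim p

    colour : Coloring F
    colour y z = does (red? (toℕ y) (toℕ z))

    colour-sym : SymmetricColoring F colour
    colour-sym y z = does-⇔ (mk⇔ Red-sym Red-sym) (red? (toℕ y) (toℕ z)) (red? (toℕ z) (toℕ y))

    red-edge : ∀ {y z} → colour y z ≡ true → Red (toℕ y) (toℕ z)
    red-edge {y} {z} = does-true (red? (toℕ y) (toℕ z))

    blue-edge : ∀ {y z} → colour y z ≡ false → ¬ Red (toℕ y) (toℕ z)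
    blue-edge {y} {z} = does-false (red? (toℕ y) (toℕ z))

    open Copies F KSqStar-sym proj₁ colour colour-sym using (fan-closed-injective) public

    rimIndex : ∀ (y : Fin (suc N)) → y ≢ zero → Σ ℕ λ b → toℕ y ≡ suc b × b < N
    rimIndex zero    y≢hub = ⊥-elim (y≢hub refl)
    rimIndex (suc y) _     = toℕ y , refl , Fin.toℕ<n y

    redSlot : ∀ {a u} → Red (suc a) u → ℕ
    redSlot {a} (near {b = b} _) = slot a b
    redSlot (antipodal _ _ _)    = suc (h + h)
    redSlot (rim-hub _)          = suc (h + h)

    extra-slot< : extra t ≡ 1 → suc (h + h) < suc (h + h) + extra t
    extra-slot< extra≡1 = subst (suc (h + h) <_) (cong (suc (h + h) +_) (sym extra≡1)) (m<m+n _ z<s)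

    redSlot< : ∀ {a u} → a < N → u < suc N → (r : Red (suc a) u) → redSlot r < suc (h + h) + extra t
    redSlot< a<N (s≤s b<N) (near p)          = ≤-trans (s≤s (slot-near a<N b<N p)) (m≤m+n _ _)
    redSlot< _   _         (antipodal p _ _) = extra-slot< (extra-antipodal t p)
    redSlot< _   _         (rim-hub p)       = extra-slot< (extra-hub t p)

    near-slot≢ : ∀ {a b} → a < N → b < N → Near ∣ a - b ∣ → slot a b ≢ suc (h + h)
    near-slot≢ a<N b<N p eq = 1+n≰n (subst (_≤ h + h) eq (slot-near a<N b<N p))

    redSlot-injective : ∀ {a u u′} → a < N → u < suc N → u′ < suc N →
      (r : Red (suc a) u) (r′ : Red (suc a) u′) → redSlot r ≡ redSlot r′ → u ≡ u′
    redSlot-injective {a} a<N (s≤s b<N) (s≤s b′<N) (near _) (near _) eq = cong suc (slot-injective a b<N b′<N eq)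
    redSlot-injective a<N (s≤s b<N) _ (near p) (antipodal _ _ _) eq = ⊥-elim (near-slot≢ a<N b<N p eq)
    redSlot-injective a<N (s≤s b<N) _ (near p) (rim-hub _)       eq = ⊥-elim (near-slot≢ a<N b<N p eq)
    redSlot-injective a<N _ (s≤s b<N) (antipodal _ _ _) (near p) eq = ⊥-elim (near-slot≢ a<N b<N p (sym eq))
    redSlot-injective a<N _ (s≤s b<N) (rim-hub _)       (near p) eq = ⊥-elim (near-slot≢ a<N b<N p (sym eq))
    redSlot-injective a<N (s≤s b<N) (s≤s b′<N) (antipodal p _ _) (antipodal p′ _ _) _ =
      cong suc (antipode-unique t a<N b<N b′<N p p′)
    redSlot-injective _ _ _ (antipodal _ ¬hub _) (rim-hub hub) _ = ⊥-elim (¬hub hub)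
    redSlot-injective _ _ _ (rim-hub hub) (antipodal _ ¬hub _) _ = ⊥-elim (¬hub hub)
    redSlot-injective _ _ _ (rim-hub _)   (rim-hub _)          _ = refl

    -- the centre is near itself, so it is counted along with its red leaves
    ¬redFan-rim : ∀ x → ¬ Fan F colour true (suc x) (suc (h + h) + extra t)
    ¬redFan-rim x fan@(g , _ , g-red) = 1+n≰n (pigeonhole-ℕ (λ i → redSlot (red i)) slots-injective
                                                  λ i → redSlot< a<N (Fin.toℕ<n ((suc x ∷ g) i)) (red i))
      where
      a = toℕ x
      a<N = Fin.toℕ<n x
      red : ∀ i → Red (suc a) (toℕ ((suc x ∷ g) i))
      red zero    = near (inj₁ (subst (_≤ h) (sym (∣n-n∣≡0 a)) z≤n))
      red (suc i) = red-edge (proj₂ (g-red i))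
      slots-injective : Injective _≡_ _≡_ (λ i → redSlot (red i))
      slots-injective {i} {j} eq = fan-closed-injective fan (Fin.toℕ-injective
        (redSlot-injective a<N (Fin.toℕ<n ((suc x ∷ g) i)) (Fin.toℕ<n ((suc x ∷ g) j)) (red i) (red j) eq))

  module IsolatedHub (t : Twist) (no-hub : ∀ a → ¬ Hub t a) where
    open Colouring t 0 public

    hub-isolated : ∀ {y} → ¬ Adj F zero y
    hub-isolated (hub≢y , y≤0 , _) = hub≢y (Fin.toℕ-injective (sym (n≤0⇒n≡0 (y≤0 refl))))

    ¬hubFan : ∀ {col m} → ¬ Fan F colour col zero (suc m)
    ¬hubFan (_ , _ , g-nbr) = hub-isolated (proj₁ (g-nbr zero))

    ¬redFan : ∀ x → ¬ Fan F colour true x (suc (h + h) + extra t)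
    ¬redFan zero    = ¬hubFan
    ¬redFan (suc x) = ¬redFan-rim x

    module BlueRimFan {x m} (fan : Fan F colour false (suc x) m) where
      g = proj₁ fan
      g-inj = proj₁ (proj₂ fan)
      g-blue = proj₂ (proj₂ fan)
      a = toℕ x
      a<N = Fin.toℕ<n x

      rim : ∀ i → Σ ℕ λ b → toℕ (g i) ≡ suc b × b < N
      rim i = rimIndex (g i) λ g≡hub → hub-isolated (KSqStar-sym (subst (Adj F (suc x)) g≡hub (proj₁ (g-blue i))))

      leaf : Fin m → ℕ
      leaf i = proj₁ (rim i)

      leaf<N : ∀ i → leaf i < N
      leaf<N i = proj₂ (proj₂ (rim i))

      leaf-blue : ∀ i → ¬ Red (suc a) (suc (leaf i))
      leaf-blue i = subst (λ u → ¬ Red (suc a) u) (proj₁ (proj₂ (rim i))) (blue-edge (proj₂ (g-blue i)))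

      leafSlot : Fin m → ℕ
      leafSlot i = slot a (leaf i)

      leafSlot-injective : Injective _≡_ _≡_ leafSlot
      leafSlot-injective {i} {j} eq = g-inj (Fin.toℕ-injective (begin
        toℕ (g i)     ≡⟨ proj₁ (proj₂ (rim i)) ⟩
        suc (leaf i)  ≡⟨ cong suc (slot-injective a (leaf<N i) (leaf<N j) eq) ⟩
        suc (leaf j)  ≡⟨ proj₁ (proj₂ (rim j)) ⟨
        toℕ (g j)     ∎))
        where open ≡-Reasoning

      leafSlot∈ : ∀ i → suc (h + h) ≤ leafSlot i × leafSlot i < N
      leafSlot∈ i = slot-far a<N (leaf<N i) (leaf-blue i ∘ near) , slot<N a (leaf i)

      leaf-nonantipodal : ∀ i → ¬ Antipodal t ∣ a - leaf i ∣
      leaf-nonantipodal i p = leaf-blue i (antipodal p (no-hub a) (no-hub (leaf i)))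

  ¬arrows-isolatedHub : ∀ {m′} t → (∀ a → ¬ Hub t a) → N ≡ suc (h + h) + (extra t + m′) →
    ¬ Arrows (KSqStar N 0) (Star (suc (h + h) + extra t)) (StarPlusE (suc m′))
  ¬arrows-isolatedHub {m′} untwisted no-hub N≡ = fanFree⇒¬arrows {F} colour colour-sym ¬redFan ¬blueFan
    where
    open IsolatedHub untwisted no-hub
    ¬blueFan : ∀ x → ¬ Fan F colour false x (suc m′)
    ¬blueFan zero    = ¬hubFan
    ¬blueFan (suc x) fan = 1+n≰n (pigeonhole-interval leafSlot leafSlot-injective
                                    λ i → proj₁ (leafSlot∈ i) , subst (leafSlot i <_) N≡ (proj₂ (leafSlot∈ i)))
      where open BlueRimFan fan
  -- the antipode of a is red, so no blue leaf takes its slot K + h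
  ¬arrows-isolatedHub {m′} t@(twisted K N≡K+K h<K _ _) no-hub N≡ = fanFree⇒¬arrows {F} colour colour-sym ¬redFan ¬blueFan
    where
    open IsolatedHub t no-hub
    open Antipodes K N≡K+K h<K
    ¬blueFan : ∀ x → ¬ Fan F colour false x (suc m′)
    ¬blueFan zero    = ¬hubFan
    ¬blueFan (suc x) fan = 1+n≰n (pigeonhole-interval ((K + h) ∷ leafSlot) slots-injective slots∈)
      where
      open BlueRimFan fan
      slots-injective : Injective _≡_ _≡_ ((K + h) ∷ leafSlot)
      slots-injective = ∷-injective (λ i eq → leaf-nonantipodal i (antipodal-slot a<N (leaf<N i) eq)) leafSlot-injective
      slots∈ : ∀ i → suc (h + h) ≤ ((K + h) ∷ leafSlot) i × ((K + h) ∷ leafSlot) i < suc (h + h) + suc m′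
      slots∈ zero    = +-monoˡ-< h h<K , subst (K + h <_) (trans (sym N≡K+K) N≡) (+-monoʳ-< K h<K)
      slots∈ (suc i) = proj₁ (leafSlot∈ i) , subst (leafSlot i <_) N≡ (proj₂ (leafSlot∈ i))

  module LowHub (K : ℕ) (N≡K+K : N ≡ K + K) (h<K : h < K) where

    -- the h antipodal pairs {b, b + K} with b < h
    data Low (b : ℕ) : Set where
      start  : b < h → Low b
      middle : K ≤ b → b < K + h → Low b

    low? : Decidable Low
    low? b with b <? h | K ≤? b | b <? K + h
    ... | yes b<h | _       | _        = yes (start b<h)
    ... | no b≮h  | yes K≤b | yes b<K+h = yes (middle K≤b b<K+h)
    ... | no b≮h  | no K≰b  | _        = no λ { (start b<h) → b≮h b<h ; (middle K≤b _) → K≰b K≤b }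
    ... | no b≮h  | yes _   | no b≮K+h = no λ { (start b<h) → b≮h b<h ; (middle _ b<K+h) → b≮K+h b<K+h }

    Low-shift : ∀ {a} → a + K < N → Low a → Low (a + K)
    Low-shift _       (start a<h)    = middle (m≤n+m K _) (subst (_< K + h) (+-comm K _) (+-monoʳ-< K a<h))
    Low-shift a+K<N (middle K≤a _) = ⊥-elim (<⇒≱ a+K<N (subst (_≤ _ + K) (sym N≡K+K) (+-monoˡ-≤ K K≤a)))

    Low-unshift : ∀ {b} → Low (b + K) → Low b
    Low-unshift {b} (start b+K<h)      = ⊥-elim (<⇒≱ (<-trans b+K<h h<K) (m≤n+m K b))
    Low-unshift {b} (middle _ b+K<K+h) = start (+-cancelʳ-< K b h (subst (b + K <_) (+-comm K h) b+K<K+h))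

    Low-antipodal : ∀ {a b} → b < N → ∣ a - b ∣ ≡ K → Low a → Low b
    Low-antipodal {a} {b} b<N δ≡K low-a with ≤-total a b
    ... | inj₁ a≤b = subst Low (sym b≡) (Low-shift (subst (_< N) b≡ b<N) low-a)
      where b≡ = ∣-∣≡⇒≡+ a≤b δ≡K
    ... | inj₂ b≤a = Low-unshift (subst Low (∣-∣≡⇒≡+ b≤a (trans (∣-∣-comm b a) δ≡K)) low-a)

    t : Twist
    t = twisted K N≡K+K h<K Low low?

    open Colouring t (N ∸ 1) public

    K+h<N : K + h < N
    K+h<N = subst (K + h <_) (sym N≡K+K) (+-monoʳ-< K h<K)

    K+h≤N∸1 : K + h ≤ N ∸ 1
    K+h≤N∸1 = subst (K + h ≤_) (pred[m∸n]≡m∸[1+n] N 0) (<⇒≤pred K+h<N)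

    lowSlot : ∀ {b} → Low b → ℕ
    lowSlot {b} (start _)    = K + (h + b)
    lowSlot {b} (middle _ _) = b

    lowSlot∈ : ∀ {b} (l : Low b) → K ≤ lowSlot l × lowSlot l < K + (h + h)
    lowSlot∈ (start b<h)         = m≤m+n K _ , +-monoʳ-< K (+-monoʳ-< h b<h)
    lowSlot∈ (middle K≤b b<K+h)  = K≤b , ≤-trans b<K+h (+-monoʳ-≤ K (m≤n+m h h))

    lowSlot-injective : ∀ {b b′} (l : Low b) (l′ : Low b′) → lowSlot l ≡ lowSlot l′ → b ≡ b′
    lowSlot-injective (start _)      (start _)      eq = +-cancelˡ-≡ h _ _ (+-cancelˡ-≡ K _ _ eq)
    lowSlot-injective (middle _ _)   (middle _ _)   eq = eq
    lowSlot-injective (start _)      (middle _ b′<) eq = ⊥-elim (<⇒≱ b′< (subst (K + h ≤_) eq (+-monoʳ-≤ K (m≤m+n h _))))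
    lowSlot-injective (middle _ b<)  (start _)      eq = ⊥-elim (<⇒≱ b< (subst (K + h ≤_) (sym eq) (+-monoʳ-≤ K (m≤m+n h _))))

    data Gap (b : ℕ) : Set where
      first  : h ≤ b → b < K → Gap b
      second : K + h ≤ b → Gap b

    gap : ∀ {b} → ¬ Low b → Gap b
    gap {b} ¬low with b <? h | b <? K | b <? K + h
    ... | yes b<h | _       | _        = ⊥-elim (¬low (start b<h))
    ... | no b≮h  | yes b<K | _        = first (≮⇒≥ b≮h) b<K
    ... | no _    | no b≮K  | yes b<K+h = ⊥-elim (¬low (middle (≮⇒≥ b≮K) b<K+h))
    ... | no _    | no _    | no b≮K+h = second (≮⇒≥ b≮K+h)

    gapSlot : ∀ {b} → Gap b → ℕ
    gapSlot {b} (first _ _) = b + h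
    gapSlot {b} (second _)  = b

    gapSlot∈ : ∀ {b} → b < N ∸ 1 → (g : Gap b) → h + h ≤ gapSlot g × gapSlot g < N ∸ 1
    gapSlot∈ b<N-1 (first h≤b b<K) = +-monoˡ-≤ h h≤b , <-≤-trans (+-monoˡ-< h b<K) K+h≤N∸1
    gapSlot∈ b<N-1 (second K+h≤b)  = ≤-trans (+-monoˡ-≤ h (<⇒≤ h<K)) K+h≤b , b<N-1

    gapSlot-injective : ∀ {b b′} (g : Gap b) (g′ : Gap b′) → gapSlot g ≡ gapSlot g′ → b ≡ b′
    gapSlot-injective (first _ _) (first _ _) eq = +-cancelʳ-≡ h _ _ eq
    gapSlot-injective (second _)  (second _)  eq = eq
    gapSlot-injective (first _ b<K) (second K+h≤b′) eq = ⊥-elim (<⇒≱ (+-monoˡ-< h b<K) (subst (K + h ≤_) (sym eq) K+h≤b′))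
    gapSlot-injective (second K+h≤b) (first _ b′<K) eq = ⊥-elim (<⇒≱ (+-monoˡ-< h b′<K) (subst (K + h ≤_) eq K+h≤b))

    open Antipodes K N≡K+K h<K

    hubRed : ∀ {u} → Red 0 u → Σ ℕ λ b → u ≡ suc b × Low b
    hubRed (hub-rim low) = _ , refl , low

    ¬redFan-hub : ¬ Fan F colour true zero (suc (h + h) + 1)
    ¬redFan-hub (g , g-inj , g-red) = 1+n≰n (≤-trans (m≤m+n (suc (h + h)) 1)
      (pigeonhole-interval (λ i → lowSlot (low i)) slots-injective (λ i → lowSlot∈ (low i))))
      where
      leaf : ∀ i → Σ ℕ λ b → toℕ (g i) ≡ suc b × Low b
      leaf i = hubRed (red-edge (proj₂ (g-red i)))
      low : ∀ i → Low (proj₁ (leaf i))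
      low i = proj₂ (proj₂ (leaf i))
      slots-injective : Injective _≡_ _≡_ (λ i → lowSlot (low i))
      slots-injective {i} {j} eq = g-inj (Fin.toℕ-injective (trans (proj₁ (proj₂ (leaf i)))
        (trans (cong suc (lowSlot-injective (low i) (low j) eq)) (sym (proj₁ (proj₂ (leaf j)))))))

    ¬blueFan-hub : ∀ {m′} → N ≡ suc (h + h) + m′ → ¬ Fan F colour false zero (suc m′)
    ¬blueFan-hub {m′} N≡ (g , g-inj , g-blue) = 1+n≰n (pigeonhole-interval (λ i → gapSlot (gap (¬low i))) slots-injective slots∈)
      where
      leaf : ∀ i → Σ ℕ λ b → toℕ (g i) ≡ suc b × b < N
      leaf i = rimIndex (g i) (proj₁ (proj₁ (g-blue i)) ∘ sym)
      ¬low : ∀ i → ¬ Low (proj₁ (leaf i))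
      ¬low i low = blue-edge (proj₂ (g-blue i)) (subst (Red 0) (sym (proj₁ (proj₂ (leaf i)))) (hub-rim low))
      slots∈ : ∀ i → h + h ≤ gapSlot (gap (¬low i)) × gapSlot (gap (¬low i)) < h + h + m′
      slots∈ i = subst (λ M → h + h ≤ gapSlot (gap (¬low i)) × gapSlot (gap (¬low i)) < M) (cong (_∸ 1) N≡)
        (gapSlot∈ (subst (_≤ N ∸ 1) (proj₁ (proj₂ (leaf i))) (proj₁ (proj₂ (proj₁ (g-blue i))) refl)) (gap (¬low i)))
      slots-injective : Injective _≡_ _≡_ (λ i → gapSlot (gap (¬low i)))
      slots-injective {i} {j} eq = g-inj (Fin.toℕ-injective (trans (proj₁ (proj₂ (leaf i)))
        (trans (cong suc (gapSlot-injective (gap (¬low i)) (gap (¬low j)) eq)) (sym (proj₁ (proj₂ (leaf j)))))))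

    blueSlot : ℕ → ℕ → ℕ
    blueSlot a zero    = K + h
    blueSlot a (suc b) = slot a b

    blueSlot∈ : ∀ {a u} → a < N → u < suc N → ¬ Red (suc a) u → suc (h + h) ≤ blueSlot a u × blueSlot a u < N
    blueSlot∈ {u = zero}    _   _         _    = +-monoˡ-< h h<K , K+h<N
    blueSlot∈ {a} {suc b} a<N (s≤s b<N) blue = slot-far a<N b<N (blue ∘ near) , slot<N a b

    antipode-red : ∀ {a b} → a < N → b < N → ¬ Red (suc a) 0 → slot a b ≡ K + h → Red (suc a) (suc b)
    antipode-red {a} {b} a<N b<N ¬hub eq =
      antipodal δ≡K (¬hub ∘ rim-hub) (¬hub ∘ rim-hub ∘ Low-antipodal a<N (trans (∣-∣-comm b a) δ≡K))
      where δ≡K = antipodal-slot a<N b<N eq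

    blueSlot-injective : ∀ {a u u′} → a < N → u < suc N → u′ < suc N → ¬ Red (suc a) u → ¬ Red (suc a) u′ →
      blueSlot a u ≡ blueSlot a u′ → u ≡ u′
    blueSlot-injective {u = zero}  {zero}   _   _         _          _    _    _  = refl
    blueSlot-injective {a} {suc b} {suc b′} a<N (s≤s b<N) (s≤s b′<N) _    _    eq = cong suc (slot-injective a b<N b′<N eq)
    blueSlot-injective {u = zero}  {suc b′} a<N _         (s≤s b′<N) blue blue′ eq = ⊥-elim (blue′ (antipode-red a<N b′<N blue (sym eq)))
    blueSlot-injective {u = suc b} {zero}   a<N (s≤s b<N) _          blue blue′ eq = ⊥-elim (blue (antipode-red a<N b<N blue′ eq))

    ¬blueFan-rim : ∀ {m′} → N ≡ suc (h + h) + m′ → ∀ x → ¬ Fan F colour false (suc x) (suc m′)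
    ¬blueFan-rim N≡ x fan@(g , g-inj , g-blue) = 1+n≰n (pigeonhole-interval (λ i → blueSlot a (toℕ (g i))) slots-injective
      λ i → proj₁ (slots∈ i) , subst (blueSlot a (toℕ (g i)) <_) N≡ (proj₂ (slots∈ i)))
      where
      a = toℕ x
      a<N = Fin.toℕ<n x
      blue : ∀ i → ¬ Red (suc a) (toℕ (g i))
      blue i = blue-edge (proj₂ (g-blue i))
      slots∈ : ∀ i → suc (h + h) ≤ blueSlot a (toℕ (g i)) × blueSlot a (toℕ (g i)) < N
      slots∈ i = blueSlot∈ a<N (Fin.toℕ<n (g i)) (blue i)
      slots-injective : Injective _≡_ _≡_ (λ i → blueSlot a (toℕ (g i)))
      slots-injective {i} {j} eq = g-inj (Fin.toℕ-injective (blueSlot-injective a<N (Fin.toℕ<n (g i)) (Fin.toℕ<n (g j)) (blue i) (blue j) eq))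

  ¬arrows-lowHub : ∀ {K m′} → N ≡ K + K → h < K → N ≡ suc (h + h) + m′ →
    ¬ Arrows (KSqStar N (N ∸ 1)) (Star (suc (h + h) + 1)) (StarPlusE (suc m′))
  ¬arrows-lowHub {K} N≡K+K h<K N≡ = fanFree⇒¬arrows {F} colour colour-sym ¬redFan ¬blueFan
    where
    open LowHub K N≡K+K h<K
    ¬redFan : ∀ x → ¬ Fan F colour true x (suc (h + h) + 1)
    ¬redFan zero    = ¬redFan-hub
    ¬redFan (suc x) = ¬redFan-rim x
    ¬blueFan : ∀ x → ¬ Fan F colour false x _
    ¬blueFan zero    = ¬blueFan-hub N≡
    ¬blueFan (suc x) = ¬blueFan-rim N≡ x

-- The three cases

half< : ∀ {h K} → h + h < K + K → h < K
half< h+h<K+K = ≰⇒> λ K≤h → <⇒≱ h+h<K+K (+-mono-≤ K≤h K≤h)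

starCritical-large : ∀ {n m′} → m′ < n →
  IsStarCriticalRamseyNumber (Star n) (StarPlusE (suc (suc m′))) (n + 1)
starCritical-large {suc n′} {m′} m′<n = starCritical (s≤s z≤n) upper lower
  where
  n = suc n′
  H = StarPlusE (suc (suc m′))
  upper : Arrows (KSqStar (n + n) (n + 1)) (Star n) H
  upper = subst (λ k → Arrows (KSqStar (n + n) k) (Star n) H) (+-comm 1 n) (arrows-large m′<n)
  lower : ¬ Arrows (KSqStar (n + n) (n + 1 ∸ 1)) (Star n) H
  lower = subst (λ k → ¬ Arrows (KSqStar (n + n) k) (Star n) H) (sym (m+n∸n≡m n 1)) (Bipartite.¬arrows n′)

starCritical-even : ∀ {n₁ m′} → suc n₁ ≤ m′ → Odd n₁ → Even (suc n₁ + m′) →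
  IsStarCriticalRamseyNumber (Star (suc n₁)) (StarPlusE (suc (suc m′))) (suc n₁ + m′)
starCritical-even {n₁} {m′} n≤m′ n₁-odd M-even with odd-half n₁-odd | even-half M-even
... | h , refl | K , M≡K+K = starCritical (s≤s z≤n) (arrows-even n≤m′ n₁-odd M-even) lower
  where
  M = suc (suc (h + h)) + m′
  H = StarPlusE (suc (suc m′))
  h+h<M : h + h < M
  h+h<M = s≤s (≤-trans (n≤1+n (h + h)) (m≤m+n (suc (h + h)) m′))
  lower : ¬ Arrows (KSqStar M (M ∸ 1)) (Star (suc (suc (h + h)))) H
  lower = subst (λ n → ¬ Arrows (KSqStar M (M ∸ 1)) (Star n) H) (+-comm (suc (h + h)) 1)
    (Circulant.¬arrows-lowHub M h h+h<M M≡K+K (half< {h} {K} (subst (h + h <_) M≡K+K h+h<M))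
      (sym (+-suc (suc (h + h)) m′)))

starCritical-odd : ∀ {n₀ m′} → suc n₀ ≤ m′ → Odd (suc n₀) ⊎ Odd (suc (suc m′)) →
  IsStarCriticalRamseyNumber (Star (suc n₀)) (StarPlusE (suc (suc m′))) 1
starCritical-odd {n₀} {m′} n≤m′ odd with parity (suc n₀) | odd
... | inj₂ (h , refl) | _ = starCritical (s≤s z≤n) (arrows-odd n≤m′) lower
  where
  N = suc (suc (h + h) + m′)
  H = StarPlusE (suc (suc m′))
  h+h<N : h + h < N
  h+h<N = s≤s (≤-trans (n≤1+n (h + h)) (m≤m+n (suc (h + h)) m′))
  lower : ¬ Arrows (KSqStar N 0) (Star (suc (h + h))) H
  lower = subst (λ n → ¬ Arrows (KSqStar N 0) (Star n) H) (+-identityʳ (suc (h + h)))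
    (Circulant.¬arrows-isolatedHub N h h+h<N Circulant.untwisted (λ _ ()) (sym (+-suc (suc (h + h)) m′)))
... | inj₁ (q , n≡) | inj₁ n-odd = ⊥-elim (n-odd (subst (2 ∣_) (sym n≡) (double-even q)))
... | inj₁ (zero , ()) | inj₂ _
... | inj₁ (suc h , refl) | inj₂ m-odd with odd-half m-odd
...   | zero  , ()
...   | suc r , refl = starCritical (s≤s z≤n) (arrows-odd n≤m′) lower
  where
  N = suc (suc (h + suc h) + (r + suc r))
  H = StarPlusE (suc (suc (r + suc r)))
  h+h<N : h + h < N
  h+h<N = s≤s (≤-trans (+-monoʳ-≤ h (n≤1+n h)) (≤-trans (n≤1+n _) (m≤m+n _ (r + suc r))))
  n≡ : ∀ h → suc (h + h) + 1 ≡ suc (h + suc h)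
  n≡ = solve-∀
  N≡ : ∀ h r → suc (suc (h + suc h) + (r + suc r)) ≡ suc (h + h) + (1 + suc (r + suc r))
  N≡ = solve-∀
  N≡K+K : ∀ h r → suc (suc (h + suc h) + (r + suc r)) ≡ (suc h + suc r) + (suc h + suc r)
  N≡K+K = solve-∀
  twist = Circulant.twisted (suc h + suc r) (N≡K+K h r) (s≤s (m≤m+n h (suc r))) (λ _ → ⊥) (λ _ → no λ ())
  lower : ¬ Arrows (KSqStar N 0) (Star (suc (h + suc h))) H
  lower = subst (λ n → ¬ Arrows (KSqStar N 0) (Star n) H) (n≡ h)
    (Circulant.¬arrows-isolatedHub N h h+h<N twist (λ _ ()) (N≡ h r))

lemma2 : (n m : ℕ) → 3 ≤ n → 3 ≤ m →
    ((Even n × Even m × n + 2 ≤ m →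
        IsStarCriticalRamseyNumber (Star n) (StarPlusE m) (n + m ∸ 2)) ×
     ((Odd n ⊎ Odd m) × n + 2 ≤ m →
        IsStarCriticalRamseyNumber (Star n) (StarPlusE m) 1) ×
     (m < n + 2 →
        IsStarCriticalRamseyNumber (Star n) (StarPlusE m) (n + 1)))
lemma2 (suc n₀) (suc (suc m′)) _ (s≤s (s≤s (s≤s _))) =
  (λ (n-even , m-even , n+2≤m) → subst (IsStarCriticalRamseyNumber _ _) (sym n+m∸2)
     (starCritical-even (n≤m′ n+2≤m) (λ 2∣n₀ → even⇒odd-suc 2∣n₀ n-even)
       (∣m∣n⇒∣m+n n-even (∣m+n∣m⇒∣n m-even ∣-refl)))) ,
  (λ (odd , n+2≤m) → starCritical-odd (n≤m′ n+2≤m) odd) ,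
  λ m<n+2 → starCritical-large (≤-pred (≤-pred (subst (suc (suc (suc m′)) ≤_) (+-comm (suc n₀) 2) m<n+2)))
  where
  n≤m′ : suc n₀ + 2 ≤ suc (suc m′) → suc n₀ ≤ m′
  n≤m′ le = ≤-pred (≤-pred (subst (_≤ suc (suc m′)) (+-comm (suc n₀) 2) le))
  n+m∸2 : suc n₀ + suc (suc m′) ∸ 2 ≡ suc n₀ + m′
  n+m∸2 = cong (_∸ 2) (trans (+-suc (suc n₀) (suc m′)) (cong suc (+-suc (suc n₀) m′)))
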